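{- Let $t>1$ and $r\geq 1$ be integers, $V=\mathbb{F}_{2^t}^r$, and let $U$ be an $\mathbb{F}_2$-vector subspace of $V$. Then $L_U$ is a scattered $\mathbb{F}_2$-linear set of $PG(r-1,2^t)=PG(V,\mathbb{F}_{2^t})$ if and only if $\mathcal{K}_U=\{P_v : v\in U\}$ is a cap (hence a translation cap) in $AG(r,2^t)$. In this sense scattered $\mathbb{F}_2$-linear sets in $PG(r-1,2^t)$ correspond to translation caps in $AG(r,2^t)$ and vice versa.
   Context: For $v=(a_1,\dots,a_r)\in\mathbb{F}_{2^t}^r$, $P_v$ denotes the affine point of $AG(r,2^t)$ with coordinates $(a_1,\dots,a_r)$. For an additive subgroup $G$ of $\mathbb{F}_{2^t}^r$, $\mathcal{K}_G=\{P_v: v\in G\}$; a translation cap is a cap (a set of points no three collinear) of $AG(r,2^t)$ of the form $\mathcal{K}_G$ for some additive subgroup $G$. For an $\mathbb{F}_2$-subspace $U$ of $V$, $L_U=\{\langle u\rangle_{\mathbb{F}_{2^t}} : u\in U\setminus\{0\}\}$, and $L_U$ is scattered if $\dim_{\mathbb{F}_2}(U\cap\langle v\rangle_{\mathbb{F}_{2^t}})=1$ for every point $\langle v\rangle\in L_U$. -}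

module Defs where

open import Level using (0ℓ)
open import Data.Nat using (ℕ; _^_)
open import Data.Fin using (Fin)
open import Data.Vec using (Vec; replicate; zipWith; map)
open import Data.Product using (Σ; _×_; ∃; ∃-syntax; _,_)
open import Data.Sum using (_⊎_)
open import Relation.Nullary using (¬_)
open import Relation.Binary using (DecidableEquality)
open import Relation.Binary.PropositionalEquality using (_≡_; _≢_)
open import Algebra.Structures using (IsCommutativeRing)
open import Function.Bundles using (_↔_)

record FiniteField (q : ℕ) : Set₁ where
  infixl 6 _+_
  infixl 7 _*_
  field
    Carrier : Set
    _+_ _*_ : Carrier → Carrier → Carrier
    -_ : Carrier → Carrier
    0# 1# : Carrier
    isCommutativeRing : IsCommutativeRing _≡_ _+_ _*_ -_ 0# 1#
    0≢1 : 0# ≢ 1#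
    inverse : ∀ x → x ≢ 0# → ∃[ y ] (x * y ≡ 1#)
    _≟_ : DecidableEquality Carrier
    card : Carrier ↔ Fin q

GF2^ : ℕ → Set₁
GF2^ t = FiniteField (2 ^ t)

module Geometry {q : ℕ} (F : FiniteField q) (r : ℕ) where
  open FiniteField F

  -- V = F^r ; the affine point P_v of AG(r,q) is identified with v ∈ V.
  V : Set
  V = Vec Carrier r

  𝟎 : V
  𝟎 = replicate r 0#

  _⊕_ : V → V → V
  _⊕_ = zipWith _+_

  _·_ : Carrier → V → V
  λ' · v = map (λ' *_) v

  Subset : Set₁
  Subset = V → Set

  -- F_2-subspace of V: contains 0 and closed under addition
  -- (closure under the scalars 0,1 of F_2 is then automatic).
  record IsF2Subspace (U : Subset) : Set where
    field
      zero-mem : U 𝟎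
      add-mem  : ∀ {x y} → U x → U y → U (x ⊕ y)

  _∩span_ : Subset → V → Subset
  (U ∩span u) x = U x × ∃[ λ' ] (x ≡ λ' · u)

  -- An F_2-subspace W has F_2-dimension 1 iff it has a basis consisting of a
  -- single nonzero vector w, i.e. W = ⟨w⟩_{F_2} = {0, w}.
  HasF2Dim1 : Subset → Set
  HasF2Dim1 W = ∃[ w ] (w ≢ 𝟎 × (∀ x → (W x → (x ≡ 𝟎 ⊎ x ≡ w)) × ((x ≡ 𝟎 ⊎ x ≡ w) → W x)))

  -- L_U is scattered: dim_{F_2}(U ∩ ⟨u⟩) = 1 for every point ⟨u⟩ of L_U,
  -- i.e. for every nonzero u ∈ U.
  Scattered : Subset → Set
  Scattered U = ∀ u → U u → u ≢ 𝟎 → HasF2Dim1 (U ∩span u)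

  OnLine : V → V → V → Set
  OnLine p d x = ∃[ λ' ] (x ≡ p ⊕ (λ' · d))

  Collinear : V → V → V → Set
  Collinear a b c = ∃[ p ] ∃[ d ] (d ≢ 𝟎 × OnLine p d a × OnLine p d b × OnLine p d c)

  IsCap : Subset → Set
  IsCap K = ∀ a b c → K a → K b → K c → a ≢ b → a ≢ c → b ≢ c → ¬ Collinear a b c

  -- K_U = {P_v : v ∈ U}; points P_v are identified with v.
  K : Subset → Subset
  K U = U

module Submission where

-- Let U be an additive subgroup of V = F^r, F a finite field.
--  * If L_U is scattered and a, b, c ∈ U are distinct collinear points, then
--    b - a and c - a are nonzero F-multiples of one another lying in U, hence
--    both lie in U ∩ ⟨b - a⟩ = {0, w}; so b - a = w = c - a and b = c.
--  * If K_U is a cap and u ∈ U is nonzero, any x ∈ U ∩ ⟨u⟩ other than 0, u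
--    would make 0, u, x three distinct collinear points of U; so U ∩ ⟨u⟩ = {0, u}.
-- Taking differences needs U to be closed under negation.  Only closure under
-- addition is assumed, so we use that in a finite field -1 is a sum of copies
-- of 1 (the characteristic is finite, by the pigeonhole principle).

open import Defs
open import Data.Nat using (ℕ; _<_; _≤_)
open import Function.Bundles using (_⇔_)

open import Level using (0ℓ)
open import Data.Nat using (zero; suc)
open import Data.Nat.Properties using (n<1+n; <⇒≢)
open import Data.Fin using (Fin; toℕ)
open import Data.Fin.Properties using (pigeonhole)
open import Data.Vec using (Vec; []; _∷_; replicate; zipWith; map)
open import Data.Vec.Properties using (∷-injective; ≡-dec; map-cong; map-const; map-id; map-∘)
open import Data.Product using (∃-syntax; _,_; proj₁; proj₂)
open import Data.Sum using (_⊎_; inj₁; inj₂)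
open import Data.Empty using (⊥-elim)
open import Relation.Nullary using (yes; no)
open import Relation.Binary.PropositionalEquality
  using (_≡_; _≢_; ≢-sym; refl; sym; trans; cong; cong₂; subst; module ≡-Reasoning)
open import Algebra.Bundles using (CommutativeRing)
open import Function.Bundles using (Inverse; Injection; mk⇔)
open import Function.Properties.Inverse using (↔⇒↣)

module FieldFacts {q : ℕ} (F : FiniteField q) where
  open FiniteField F public

  ring : CommutativeRing 0ℓ 0ℓ
  ring = record { isCommutativeRing = isCommutativeRing }

  open CommutativeRing ring public
    using (*-assoc; *-comm; distribʳ; zeroˡ; *-identityˡ; *-identityʳ; -‿inverseʳ;
           +-identityˡ; +-rawMonoid)
  open import Algebra.Properties.Ring (CommutativeRing.ring ring) public
    using (-1*x≈-x; -‿distribˡ-*; -‿+-comm; +-cancelˡ; +-cancelʳ;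
           +-inverseʳ-unique; x∙y⁻¹≈ε⇒x≈y)
  open import Algebra.Properties.CommutativeSemigroup
    (CommutativeRing.+-commutativeSemigroup ring) using (interchange)
  -- n × x is the n-fold sum x + ⋯ + x; n × 1# is the image of n in F.
  open import Algebra.Definitions.RawMonoid +-rawMonoid public using (_×_)
  open ≡-Reasoning

  difference-along-line : ∀ p a b d → (p + b * d) + - (p + a * d) ≡ (b + - a) * d
  difference-along-line p a b d = begin
    (p + b * d) + - (p + a * d)      ≡⟨ cong ((p + b * d) +_) (sym (-‿+-comm p (a * d))) ⟩
    (p + b * d) + (- p + - (a * d))  ≡⟨ interchange p (b * d) (- p) (- (a * d)) ⟩
    (p + - p) + (b * d + - (a * d))  ≡⟨ cong (_+ (b * d + - (a * d))) (-‿inverseʳ p) ⟩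
    0# + (b * d + - (a * d))         ≡⟨ +-identityˡ _ ⟩
    b * d + - (a * d)                ≡⟨ cong (b * d +_) (-‿distribˡ-* a d) ⟩
    b * d + (- a) * d                ≡⟨ sym (distribʳ d b (- a)) ⟩
    (b + - a) * d                    ∎

  cancel-inverse : ∀ {x y} z → y * x ≡ 1# → (z * x) * y ≡ z
  cancel-inverse {x} {y} z yx≡1 = begin
    (z * x) * y  ≡⟨ *-assoc z x y ⟩
    z * (x * y)  ≡⟨ cong (z *_) (trans (*-comm x y) yx≡1) ⟩
    z * 1#       ≡⟨ *-identityʳ z ⟩
    z            ∎

  collision⇒characteristic : ∀ m n → m × 1# ≡ n × 1# → m ≢ n → ∃[ k ] (suc k × 1# ≡ 0#)
  collision⇒characteristic zero    zero    _ m≢n = ⊥-elim (m≢n refl)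
  collision⇒characteristic zero    (suc n) e _   = n , sym e
  collision⇒characteristic (suc m) zero    e _   = m , e
  collision⇒characteristic (suc m) (suc n) e m≢n =
    collision⇒characteristic m n (+-cancelˡ 1# _ _ e) (λ m≡n → m≢n (cong suc m≡n))

  -- F has finite characteristic: among the q + 1 elements 0 × 1#, …, q × 1#
  -- of the q-element field two coincide.
  finite-characteristic : ∃[ k ] (suc k × 1# ≡ 0#)
  finite-characteristic
    with pigeonhole (n<1+n q) (λ (i : Fin (suc q)) → Inverse.to card (toℕ i × 1#))
  ... | i , j , i<j , same-index =
    collision⇒characteristic (toℕ i) (toℕ j) (Injection.injective (↔⇒↣ card) same-index) (<⇒≢ i<j)

  minus-one-is-multiple : ∃[ k ] (k × 1# ≡ - 1#)
  minus-one-is-multiple with finite-characteristic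
  ... | k , 1+k≡0 = k , +-inverseʳ-unique 1# (k × 1#) 1+k≡0

-- Coordinatewise operations on Fⁿ (for every n; definitionally those of
-- Geometry F n) and the vector identities inherited from the field.
module Coordinates {q : ℕ} (F : FiniteField q) where
  open FieldFacts F

  infixl 6 _⊕_ _⊖_
  infixr 7 _·_

  𝟎 : ∀ {n} → Vec Carrier n
  𝟎 {n} = replicate n 0#

  _⊕_ : ∀ {n} → Vec Carrier n → Vec Carrier n → Vec Carrier n
  _⊕_ = zipWith _+_

  _·_ : ∀ {n} → Carrier → Vec Carrier n → Vec Carrier n
  λ' · v = map (λ' *_) v

  ⊝_ : ∀ {n} → Vec Carrier n → Vec Carrier n
  ⊝_ = map -_

  _⊖_ : ∀ {n} → Vec Carrier n → Vec Carrier n → Vec Carrier n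
  u ⊖ v = u ⊕ ⊝ v

  ·-zero : ∀ {n} (u : Vec Carrier n) → 0# · u ≡ 𝟎
  ·-zero u = trans (map-cong zeroˡ u) (map-const u 0#)

  ·-one : ∀ {n} (u : Vec Carrier n) → 1# · u ≡ u
  ·-one u = trans (map-cong *-identityˡ u) (map-id u)

  ·-assoc : ∀ {n} λ' μ (u : Vec Carrier n) → λ' · μ · u ≡ (λ' * μ) · u
  ·-assoc λ' μ u = trans (sym (map-∘ (λ' *_) (μ *_) u)) (map-cong (λ x → sym (*-assoc λ' μ x)) u)

  ·-minus-one : ∀ {n} (u : Vec Carrier n) → (- 1#) · u ≡ ⊝ u
  ·-minus-one = map-cong -1*x≈-x

  ·-suc-multiple : ∀ {n} k (u : Vec Carrier n) → (suc k × 1#) · u ≡ u ⊕ (k × 1#) · u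
  ·-suc-multiple k []      = refl
  ·-suc-multiple k (x ∷ u) =
    cong₂ _∷_ (trans (distribʳ x 1# (k × 1#)) (cong (_+ (k × 1#) * x) (*-identityˡ x)))
              (·-suc-multiple k u)

  ⊕-identityˡ : ∀ {n} (u : Vec Carrier n) → 𝟎 ⊕ u ≡ u
  ⊕-identityˡ []      = refl
  ⊕-identityˡ (x ∷ u) = cong₂ _∷_ (+-identityˡ x) (⊕-identityˡ u)

  line-difference : ∀ {n} (p d : Vec Carrier n) a b → (p ⊕ b · d) ⊖ (p ⊕ a · d) ≡ (b + - a) · d
  line-difference []      []      a b = refl
  line-difference (x ∷ p) (y ∷ d) a b =
    cong₂ _∷_ (difference-along-line x a b y) (line-difference p d a b)

  ⊖-zero⇒≡ : ∀ {n} (u v : Vec Carrier n) → u ⊖ v ≡ 𝟎 → u ≡ v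
  ⊖-zero⇒≡ []      []      _ = refl
  ⊖-zero⇒≡ (x ∷ u) (y ∷ v) e with ∷-injective e
  ... | e₁ , e₂ = cong₂ _∷_ (x∙y⁻¹≈ε⇒x≈y x y e₁) (⊖-zero⇒≡ u v e₂)

  ⊖-cancelʳ : ∀ {n} (u v w : Vec Carrier n) → u ⊖ w ≡ v ⊖ w → u ≡ v
  ⊖-cancelʳ []      []      []      _ = refl
  ⊖-cancelʳ (x ∷ u) (y ∷ v) (z ∷ w) e with ∷-injective e
  ... | e₁ , e₂ = cong₂ _∷_ (+-cancelʳ (- z) x y e₁) (⊖-cancelʳ u v w e₂)

module Proof {q : ℕ} (F : FiniteField q) (r : ℕ) where
  open FieldFacts F
  open Coordinates F
  open Geometry F r using (V; Subset; IsF2Subspace; _∩span_; HasF2Dim1; Scattered; Collinear; IsCap)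

  dim1-nonzero-unique : ∀ {W} → HasF2Dim1 W → ∀ {x y} → W x → W y → x ≢ 𝟎 → y ≢ 𝟎 → x ≡ y
  dim1-nonzero-unique {W} (w , _ , members) {x} {y} Wx Wy x≢0 y≢0 =
    trans (the-nonzero x Wx x≢0) (sym (the-nonzero y Wy y≢0))
    where
    the-nonzero : ∀ z → W z → z ≢ 𝟎 → z ≡ w
    the-nonzero z Wz z≢0 with proj₁ (members z) Wz
    ... | inj₁ z≡0 = ⊥-elim (z≢0 z≡0)
    ... | inj₂ z≡w = z≡w

  collinear⇒proportional : ∀ {a b c : V} → Collinear a b c → a ≢ b → ∃[ μ ] (c ⊖ a ≡ μ · (b ⊖ a))
  collinear⇒proportional {a} {b} {c} (p , d , _ , (α , a≡) , (β , b≡) , (γ , c≡)) a≢b =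
    μ , (begin
      c ⊖ a          ≡⟨ c-a≡ ⟩
      (γ + - α) · d  ≡⟨ cong (_· d) (sym (cancel-inverse (γ + - α) δι≡1)) ⟩
      (μ * δ) · d    ≡⟨ sym (·-assoc μ δ d) ⟩
      μ · δ · d      ≡⟨ cong (μ ·_) (sym b-a≡) ⟩
      μ · (b ⊖ a)    ∎)
    where
    open ≡-Reasoning
    δ : Carrier
    δ = β + - α
    b-a≡ : b ⊖ a ≡ δ · d
    b-a≡ = trans (cong₂ _⊖_ b≡ a≡) (line-difference p d α β)
    c-a≡ : c ⊖ a ≡ (γ + - α) · d
    c-a≡ = trans (cong₂ _⊖_ c≡ a≡) (line-difference p d α γ)
    δ≢0 : δ ≢ 0#
    δ≢0 δ≡0 = a≢b (trans a≡ (trans (cong (λ s → p ⊕ s · d) (sym (x∙y⁻¹≈ε⇒x≈y β α δ≡0))) (sym b≡)))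
    ι : Carrier
    ι = proj₁ (inverse δ δ≢0)
    δι≡1 : δ * ι ≡ 1#
    δι≡1 = proj₂ (inverse δ δ≢0)
    μ : Carrier
    μ = (γ + - α) * ι

  span-collinear : ∀ (u : V) λ' → u ≢ 𝟎 → Collinear 𝟎 u (λ' · u)
  span-collinear u λ' u≢0 =
    𝟎 , u , u≢0 , (0# , sym (trans (⊕-identityˡ _) (·-zero u)))
                , (1# , sym (trans (⊕-identityˡ _) (·-one u)))
                , (λ' , sym (⊕-identityˡ _))

  module _ (U : Subset) (U-subspace : IsF2Subspace U) where
    open IsF2Subspace U-subspace

    multiple-mem : ∀ k {u} → U u → U ((k × 1#) · u)
    multiple-mem zero    {u} Uu = subst U (sym (·-zero u)) zero-mem
    multiple-mem (suc k) {u} Uu = subst U (sym (·-suc-multiple k u)) (add-mem Uu (multiple-mem k Uu))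

    ⊖-mem : ∀ {u v} → U u → U v → U (u ⊖ v)
    ⊖-mem {u} {v} Uu Uv with minus-one-is-multiple
    ... | k , k≡-1 =
      add-mem Uu (subst U (trans (cong (_· v) k≡-1) (·-minus-one v)) (multiple-mem k Uv))

    -- Scattered ⇒ cap: for distinct collinear a, b, c in U, the differences
    -- b - a and c - a are two nonzero members of U ∩ ⟨b - a⟩, hence equal.
    scattered⇒cap : Scattered U → IsCap U
    scattered⇒cap scattered a b c Ua Ub Uc a≢b a≢c b≢c collinear
      with collinear⇒proportional collinear a≢b
    ... | μ , c-a≡μ[b-a] = b≢c (⊖-cancelʳ b c a b-a≡c-a)
      where
      b-a≢0 : b ⊖ a ≢ 𝟎
      b-a≢0 e = a≢b (sym (⊖-zero⇒≡ b a e))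
      c-a≢0 : c ⊖ a ≢ 𝟎
      c-a≢0 e = a≢c (sym (⊖-zero⇒≡ c a e))
      b-a≡c-a : b ⊖ a ≡ c ⊖ a
      b-a≡c-a = dim1-nonzero-unique (scattered (b ⊖ a) (⊖-mem Ub Ua) b-a≢0)
        (⊖-mem Ub Ua , 1# , sym (·-one (b ⊖ a))) (⊖-mem Uc Ua , μ , c-a≡μ[b-a]) b-a≢0 c-a≢0

    -- Cap ⇒ scattered: U ∩ ⟨u⟩ = {0, u}, since a third member x would make
    -- 0, u, x three distinct collinear points of U.
    cap⇒scattered : IsCap U → Scattered U
    cap⇒scattered cap u Uu u≢0 = u , u≢0 , λ x → only-0-and-u x , both-members x
      where
      only-0-and-u : ∀ x → (U ∩span u) x → x ≡ 𝟎 ⊎ x ≡ u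
      only-0-and-u x (Ux , λ' , x≡λu) with ≡-dec _≟_ x 𝟎 | ≡-dec _≟_ x u
      ... | yes x≡0 | _       = inj₁ x≡0
      ... | no _    | yes x≡u = inj₂ x≡u
      ... | no x≢0  | no x≢u  =
        ⊥-elim (cap 𝟎 u x zero-mem Uu Ux (≢-sym u≢0) (≢-sym x≢0) (≢-sym x≢u)
                  (subst (Collinear 𝟎 u) (sym x≡λu) (span-collinear u λ' u≢0)))
      both-members : ∀ x → x ≡ 𝟎 ⊎ x ≡ u → (U ∩span u) x
      both-members x (inj₁ refl) = zero-mem , 0# , sym (·-zero u)
      both-members x (inj₂ refl) = Uu , 1# , sym (·-one u)

proposition4p3 : (t r : ℕ) → 1 < t → 1 ≤ r → (F : GF2^ t) → (U : Geometry.Subset F r) → Geometry.IsF2Subspace F r U → (Geometry.Scattered F r U ⇔ Geometry.IsCap F r (Geometry.K F r U))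
proposition4p3 t r _ _ F U U-subspace =
  mk⇔ (Proof.scattered⇒cap F r U U-subspace) (Proof.cap⇒scattered F r U U-subspace)
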